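{- Let $G=(V,E)$ be an unweighted undirected graph with $n$ vertices, and let $V$ be partitioned arbitrarily into $\sqrt{n}$ equal-sized buckets $V_1,\dots,V_{\sqrt n}$. Define edge sets as follows. $E_1$: for every $i$ and every $v\in V\setminus V_i$ with $V_i\cap N_G(v)\neq\emptyset$, choose an arbitrary $c_i(v)\in V_i\cap N_G(v)$ and put $(v,c_i(v))$ in $E_1$. $E_2$: all edges $(u,v)\in E$ with $u,v$ in the same bucket. $E_3$: for every $i$ and every pair $u\neq u'$ in $V_i$ with $N_G(u)\cap N_G(u')\neq\emptyset$, choose an arbitrary $w_{uu'}\in N_G(u)\cap N_G(u')$ and put $(u,w_{uu'})$ and $(w_{uu'},u')$ in $E_3$. Then $H=(V,E_1\cup E_2\cup E_3)$ is a $3$-spanner of $G$ with $O(n\sqrt{n})$ edges.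
   Context: $N_G(u)$ denotes the set of neighbors of $u$ in $G$. A $3$-spanner of $G$ is a subgraph $H$ on the same vertex set with edges from $E$ such that $\operatorname{dist}_H(u,v)\le 3\operatorname{dist}_G(u,v)$ for all $u,v\in V$. -}

module Defs where

open import Data.Nat using (ℕ; zero; suc; _+_; _*_; _≤_)
open import Data.Fin using (Fin; zero; suc; toℕ)
open import Data.Nat using (_<ᵇ_)
open import Data.Fin.Properties using (_≟_)
open import Data.Bool using (Bool; true; false; _∧_; _∨_; not; if_then_else_; T)
open import Data.Product using (Σ; ∃; _×_; _,_)
open import Relation.Nullary.Decidable using (⌊_⌋)
open import Relation.Binary.PropositionalEquality using (_≡_; _≢_)

-- A (simple, undirected, unweighted) graph on vertex set Fin n is given by a
-- Boolean adjacency function; simplicity/undirectedness are hypotheses.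
Graph : ℕ → Set
Graph n = Fin n → Fin n → Bool

Symmetric : ∀ {n} → Graph n → Set
Symmetric {n} G = (x y : Fin n) → G x y ≡ G y x

Irreflexive : ∀ {n} → Graph n → Set
Irreflexive {n} G = (x : Fin n) → G x x ≡ false

anyF : ∀ {m} → (Fin m → Bool) → Bool
anyF {zero}  f = false
anyF {suc m} f = f zero ∨ anyF (λ i → f (suc i))

countF : ∀ {m} → (Fin m → Bool) → ℕ
countF {zero}  f = 0
countF {suc m} f = (if f zero then 1 else 0) + countF (λ i → f (suc i))

sumF : ∀ {m} → (Fin m → ℕ) → ℕ
sumF {zero}  f = 0
sumF {suc m} f = f zero + sumF (λ i → f (suc i))

edgeCount : ∀ {n} → Graph n → ℕ
edgeCount G = sumF (λ x → countF (λ y → (toℕ x <ᵇ toℕ y) ∧ G x y))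

data Walk {n} (G : Graph n) : Fin n → Fin n → ℕ → Set where
  here : ∀ {u} → Walk G u u 0
  step : ∀ {u v w ℓ} → T (G u v) → Walk G v w ℓ → Walk G u w (suc ℓ)

-- H is a 3-spanner of G: H is a subgraph of G on the same vertices and
-- dist_H(u,v) ≤ 3 dist_G(u,v), i.e. every u–v walk of length ℓ in G
-- yields a u–v walk of length ≤ 3ℓ in H (with dist = ∞ if no walk).
IsSpanner3 : ∀ {n} → Graph n → Graph n → Set
IsSpanner3 {n} G H =
  ((x y : Fin n) → T (H x y) → T (G x y)) ×
  ((u v : Fin n) (ℓ : ℕ) → Walk G u v ℓ → ∃ λ ℓ' → ℓ' ≤ 3 * ℓ × Walk H u v ℓ')

-- The construction. Vertices Fin N, buckets Fin k, bucket : Fin N → Fin k.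
-- c v i : the chosen c_i(v) ; w u u' : the chosen w_{uu'}.

module Construction {N k : ℕ} (bucket : Fin N → Fin k) (G : Graph N)
                    (c : Fin N → Fin k → Fin N) (w : Fin N → Fin N → Fin N) where

  eqF : ∀ {m} → Fin m → Fin m → Bool
  eqF a b = ⌊ a ≟ b ⌋

  cond1 : Fin N → Fin k → Bool
  cond1 v i = not (eqF (bucket v) i) ∧ anyF (λ u → eqF (bucket u) i ∧ G v u)

  cond3 : Fin N → Fin N → Bool
  cond3 u u' = eqF (bucket u) (bucket u') ∧ not (eqF u u') ∧ anyF (λ x → G u x ∧ G u' x)

  E1d : Fin N → Fin N → Bool
  E1d v y = anyF (λ i → cond1 v i ∧ eqF (c v i) y)

  E2 : Fin N → Fin N → Bool
  E2 x y = G x y ∧ eqF (bucket x) (bucket y)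

  -- (u , w_{uu'}) for a qualifying pair {u,u'}; (w_{uu'}, u') is (u', w_{u'u}) reversed
  E3d : Fin N → Fin N → Bool
  E3d u y = anyF (λ u' → cond3 u u' ∧ eqF (w u u') y)

  H : Graph N
  H x y = E1d x y ∨ E1d y x ∨ E2 x y ∨ E3d x y ∨ E3d y x

EqualBuckets : ∀ {N k} → (Fin N → Fin k) → ℕ → Set
EqualBuckets {N} {k} bucket s = (i : Fin k) → countF (λ v → ⌊ bucket v ≟ i ⌋) ≡ s

ValidC : ∀ {N k} → (Fin N → Fin k) → Graph N → (Fin N → Fin k → Fin N) → Set
ValidC {N} {k} bucket G c = (v : Fin N) (i : Fin k) → bucket v ≢ i →
  (∃ λ u → bucket u ≡ i × T (G v u)) →
  bucket (c v i) ≡ i × T (G v (c v i))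

ValidW : ∀ {N k} → (Fin N → Fin k) → Graph N → (Fin N → Fin N → Fin N) → Set
ValidW {N} {k} bucket G w =
  ((u u' : Fin N) → w u u' ≡ w u' u) ×
  ((u u' : Fin N) → bucket u ≡ bucket u' → u ≢ u' →
     (∃ λ x → T (G u x) × T (G u' x)) →
     T (G u (w u u')) × T (G u' (w u u')))

-- Each edge uv of G has a detour of length at most 3 in H: an edge inside a bucket is kept (E₂);
-- otherwise c = c_{bucket v}(u) lies in the bucket of v and, like v, is adjacent to u, so either
-- c = v or u – c – w_{cv} – v is a path in E₁ ∪ E₃. Replacing every edge of a
-- walk by its detour multiplies lengths by at most 3. For the size, every vertex has at most k
-- out-arcs in each of E₁ (one per bucket), E₂ and E₃ (only bucket-mates qualify), so counting
-- ordered pairs, with E₁ and E₃ used in both directions, H has at most 5 · k² · k edges.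
module Submission where

open import Defs
open import Data.Bool using (Bool; true; false; _∧_; _∨_; not; if_then_else_; T)
open import Data.Bool.Properties using (T-∧; T-∨)
open import Data.Empty using (⊥-elim)
open import Data.Fin using (Fin; zero; suc; toℕ)
open import Data.Fin.Properties using (_≟_; suc-injective; 0≢1+n)
open import Data.Nat using (ℕ; zero; suc; _+_; _*_; _≤_; z≤n; s≤s; _<ᵇ_)
open import Data.Nat.Properties
  using (+-0-commutativeMonoid; ≤-refl; ≤-reflexive; ≤-trans; m≤n⇒m≤1+n; +-mono-≤; +-identityʳ; *-suc; module ≤-Reasoning)
open import Algebra.Properties.CommutativeMonoid.Sum +-0-commutativeMonoid
  using (sum; sum-cong-≗; ∑-comm; ∑-distrib-+)
open import Data.Product using (∃; ∃₂; _×_; _,_; proj₁; proj₂)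
open import Data.Sum using (_⊎_; inj₁; inj₂)
open import Data.Unit using (tt)
open import Function using (_∘_; Equivalence)
open import Relation.Nullary using (¬_; yes; no)
open import Relation.Nullary.Decidable using (⌊_⌋; toWitness; fromWitness; toWitnessFalse; fromWitnessFalse)
open import Relation.Binary.PropositionalEquality using (_≡_; _≢_; refl; sym; cong; cong₂; subst; module ≡-Reasoning)

T-∧-intro : ∀ a b → T a → T b → T (a ∧ b)
T-∧-intro a b ta tb = Equivalence.from (T-∧ {a} {b}) (ta , tb)

T-∧-elim : ∀ a b → T (a ∧ b) → T a × T b
T-∧-elim a b = Equivalence.to (T-∧ {a} {b})

T-∨-introˡ : ∀ a b → T a → T (a ∨ b)
T-∨-introˡ a b = Equivalence.from (T-∨ {a} {b}) ∘ inj₁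

T-∨-introʳ : ∀ a b → T b → T (a ∨ b)
T-∨-introʳ a b = Equivalence.from (T-∨ {a} {b}) ∘ inj₂

T-∨-elim : ∀ a b → T (a ∨ b) → T a ⊎ T b
T-∨-elim a b = Equivalence.to (T-∨ {a} {b})

T-anyF-intro : ∀ {m} (f : Fin m → Bool) (i : Fin m) → T (f i) → T (anyF f)
T-anyF-intro f zero    t = T-∨-introˡ (f zero) _ t
T-anyF-intro f (suc i) t = T-∨-introʳ (f zero) _ (T-anyF-intro (f ∘ suc) i t)

T-anyF-elim : ∀ {m} (f : Fin m → Bool) → T (anyF f) → ∃ λ i → T (f i)
T-anyF-elim {suc m} f t with T-∨-elim (f zero) _ t
... | inj₁ t₀ = zero , t₀
... | inj₂ t₁ with T-anyF-elim (f ∘ suc) t₁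
...   | i , tᵢ = suc i , tᵢ

indicator : Bool → ℕ
indicator b = if b then 1 else 0

indicator-≤ : ∀ a b → (T a → T b) → indicator a ≤ indicator b
indicator-≤ true  true  _ = ≤-refl
indicator-≤ true  false h = ⊥-elim (h tt)
indicator-≤ false _     _ = z≤n

indicator-∨ : ∀ a b → indicator (a ∨ b) ≤ indicator a + indicator b
indicator-∨ true  _ = s≤s z≤n
indicator-∨ false _ = ≤-refl

sum-mono-≤ : ∀ {m} {f g : Fin m → ℕ} → (∀ i → f i ≤ g i) → sum f ≤ sum g
sum-mono-≤ {zero}  _   = z≤n
sum-mono-≤ {suc m} f≤g = +-mono-≤ (f≤g zero) (sum-mono-≤ (f≤g ∘ suc))

sum-≤ : ∀ {m d} {f : Fin m → ℕ} → (∀ i → f i ≤ d) → sum f ≤ m * d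
sum-≤ {zero}  _   = z≤n
sum-≤ {suc m} f≤d = +-mono-≤ (f≤d zero) (sum-≤ (f≤d ∘ suc))

sumF≡sum : ∀ {m} (f : Fin m → ℕ) → sumF f ≡ sum f
sumF≡sum {zero}  f = refl
sumF≡sum {suc m} f = cong (f zero +_) (sumF≡sum (f ∘ suc))

countF≡sum : ∀ {m} (f : Fin m → Bool) → countF f ≡ sum (indicator ∘ f)
countF≡sum {zero}  f = refl
countF≡sum {suc m} f = cong (indicator (f zero) +_) (countF≡sum (f ∘ suc))

countF-mono : ∀ {m} {f g : Fin m → Bool} → (∀ i → T (f i) → T (g i)) → countF f ≤ countF g
countF-mono {f = f} {g} f⊆g = begin
  countF f                ≡⟨ countF≡sum f ⟩
  sum (indicator ∘ f)     ≤⟨ sum-mono-≤ (λ i → indicator-≤ (f i) (g i) (f⊆g i)) ⟩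
  sum (indicator ∘ g)     ≡⟨ countF≡sum g ⟨
  countF g                ∎
  where open ≤-Reasoning

countF-∨ : ∀ {m} (f g : Fin m → Bool) → countF (λ i → f i ∨ g i) ≤ countF f + countF g
countF-∨ f g = begin
  countF (λ i → f i ∨ g i)                              ≡⟨ countF≡sum (λ i → f i ∨ g i) ⟩
  sum (λ i → indicator (f i ∨ g i))                     ≤⟨ sum-mono-≤ (λ i → indicator-∨ (f i) (g i)) ⟩
  sum (λ i → indicator (f i) + indicator (g i))         ≡⟨ ∑-distrib-+ (indicator ∘ f) (indicator ∘ g) ⟩
  sum (indicator ∘ f) + sum (indicator ∘ g)             ≡⟨ cong₂ _+_ (countF≡sum f) (countF≡sum g) ⟨
  countF f + countF g                                   ∎
  where open ≤-Reasoning

countF-≤ : ∀ {m} (f : Fin m → Bool) → countF f ≤ m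
countF-≤ {zero}  f = z≤n
countF-≤ {suc m} f with f zero
... | true  = s≤s (countF-≤ (f ∘ suc))
... | false = m≤n⇒m≤1+n (countF-≤ (f ∘ suc))

countF-none : ∀ {m} (f : Fin m → Bool) → (∀ i → ¬ T (f i)) → countF f ≡ 0
countF-none {zero}  f _ = refl
countF-none {suc m} f none with f zero | none zero
... | true  | ¬t = ⊥-elim (¬t tt)
... | false | _  = countF-none (f ∘ suc) (none ∘ suc)

countF-atMostOne : ∀ {m} (z : Fin m) (f : Fin m → Bool) → (∀ i → T (f i) → z ≡ i) → countF f ≤ 1
countF-atMostOne zero f only-z =
  +-mono-≤ (indicator-≤ (f zero) true _) (≤-reflexive (countF-none (f ∘ suc) (λ i → 0≢1+n ∘ only-z (suc i))))
countF-atMostOne (suc z) f only-z with f zero | only-z zero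
... | true  | z≡0 = ⊥-elim (0≢1+n (sym (z≡0 tt)))
... | false | _   = countF-atMostOne z (f ∘ suc) (λ i → suc-injective ∘ only-z (suc i))

countF-∧-≟ : ∀ {n} b (z : Fin n) → countF (λ y → b ∧ ⌊ z ≟ y ⌋) ≤ indicator b
countF-∧-≟ true  z = countF-atMostOne z (λ y → ⌊ z ≟ y ⌋) (λ _ → toWitness)
countF-∧-≟ {n} false z = ≤-reflexive (countF-none {n} (λ _ → false) (λ _ ()))

countF-image : ∀ {m n} (P : Fin m → Bool) (f : Fin m → Fin n) →
               countF (λ y → anyF (λ i → P i ∧ ⌊ f i ≟ y ⌋)) ≤ countF P
countF-image {zero} {n} P f = ≤-reflexive (countF-none {n} (λ _ → false) (λ _ ()))
countF-image {suc m} P f = begin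
  countF (λ y → (P zero ∧ ⌊ f zero ≟ y ⌋) ∨ anyF (λ i → P (suc i) ∧ ⌊ f (suc i) ≟ y ⌋))
    ≤⟨ countF-∨ (λ y → P zero ∧ ⌊ f zero ≟ y ⌋) _ ⟩
  countF (λ y → P zero ∧ ⌊ f zero ≟ y ⌋) + countF (λ y → anyF (λ i → P (suc i) ∧ ⌊ f (suc i) ≟ y ⌋))
    ≤⟨ +-mono-≤ (countF-∧-≟ (P zero) (f zero)) (countF-image (P ∘ suc) (f ∘ suc)) ⟩
  indicator (P zero) + countF (P ∘ suc)
    ∎
  where open ≤-Reasoning

arcCount : ∀ {n} → Graph n → ℕ
arcCount B = sum (λ x → countF (B x))

edgeCount≤arcCount : ∀ {n} (G : Graph n) → edgeCount G ≤ arcCount G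
edgeCount≤arcCount G = begin
  edgeCount G                                          ≡⟨ sumF≡sum (λ x → countF (λ y → (toℕ x <ᵇ toℕ y) ∧ G x y)) ⟩
  sum (λ x → countF (λ y → (toℕ x <ᵇ toℕ y) ∧ G x y))
    ≤⟨ sum-mono-≤ (λ x → countF-mono (λ y → proj₂ ∘ T-∧-elim (toℕ x <ᵇ toℕ y) (G x y))) ⟩
  arcCount G                                           ∎
  where open ≤-Reasoning

arcCount-∨ : ∀ {n a b} (A B : Graph n) → arcCount A ≤ a → arcCount B ≤ b →
             arcCount (λ x y → A x y ∨ B x y) ≤ a + b
arcCount-∨ A B A≤a B≤b = begin
  sum (λ x → countF (λ y → A x y ∨ B x y))       ≤⟨ sum-mono-≤ (λ x → countF-∨ (A x) (B x)) ⟩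
  sum (λ x → countF (A x) + countF (B x))        ≡⟨ ∑-distrib-+ (λ x → countF (A x)) (λ x → countF (B x)) ⟩
  arcCount A + arcCount B                        ≤⟨ +-mono-≤ A≤a B≤b ⟩
  _                                              ∎
  where open ≤-Reasoning

arcCount-transpose : ∀ {n} (B : Graph n) → arcCount (λ x y → B y x) ≡ arcCount B
arcCount-transpose B = begin
  sum (λ x → countF (λ y → B y x))             ≡⟨ sum-cong-≗ (λ x → countF≡sum (λ y → B y x)) ⟩
  sum (λ x → sum (λ y → indicator (B y x)))    ≡⟨ ∑-comm (λ y x → indicator (B y x)) ⟨
  sum (λ y → sum (λ x → indicator (B y x)))    ≡⟨ sum-cong-≗ (countF≡sum ∘ B) ⟨
  sum (λ y → countF (B y))                     ∎
  where open ≡-Reasoning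

arcCount-≤ : ∀ {n d} (B : Graph n) → (∀ x → countF (B x) ≤ d) → arcCount B ≤ n * d
arcCount-≤ B = sum-≤

_++ᵂ_ : ∀ {n} {G : Graph n} {u v x a b} → Walk G u v a → Walk G v x b → Walk G u x (a + b)
here     ++ᵂ q = q
step e p ++ᵂ q = step e (p ++ᵂ q)

walk-stretch : ∀ {n} {G H : Graph n} t →
               (∀ u v → T (G u v) → ∃ λ ℓ → ℓ ≤ t × Walk H u v ℓ) →
               ∀ u v ℓ → Walk G u v ℓ → ∃ λ ℓ′ → ℓ′ ≤ t * ℓ × Walk H u v ℓ′
walk-stretch t detour u .u .0 here = 0 , z≤n , here
walk-stretch t detour u v (suc ℓ) (step {v = x} e p)
  with detour u x e | walk-stretch t detour x v ℓ p
... | a , a≤t , q | b , b≤tℓ , r =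
  a + b , subst (a + b ≤_) (sym (*-suc t ℓ)) (+-mono-≤ a≤t b≤tℓ) , q ++ᵂ r

module SpannerConstruction {N k : ℕ} (bucket : Fin N → Fin k) (G : Graph N)
                           (c : Fin N → Fin k → Fin N) (w : Fin N → Fin N → Fin N) where
  open Construction bucket G c w

  cond1-intro : ∀ {v u} → bucket v ≢ bucket u → T (G v u) → T (cond1 v (bucket u))
  cond1-intro {v} {u} v∉ vu =
    T-∧-intro (not (eqF (bucket v) (bucket u))) _ (fromWitnessFalse v∉)
      (T-anyF-intro (λ u′ → eqF (bucket u′) (bucket u) ∧ G v u′) u
        (T-∧-intro (eqF (bucket u) (bucket u)) _ (fromWitness refl) vu))

  cond1-elim : ∀ {v i} → T (cond1 v i) → bucket v ≢ i × ∃ λ u → bucket u ≡ i × T (G v u)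
  cond1-elim {v} {i} t with T-∧-elim (not (eqF (bucket v) i)) _ t
  ... | v∉ , ∃u with T-anyF-elim (λ u → eqF (bucket u) i ∧ G v u) ∃u
  ...   | u , tu with T-∧-elim (eqF (bucket u) i) _ tu
  ...     | u∈ , vu = toWitnessFalse v∉ , u , toWitness u∈ , vu

  cond3-intro : ∀ {u u′ x} → bucket u ≡ bucket u′ → u ≢ u′ → T (G u x) → T (G u′ x) → T (cond3 u u′)
  cond3-intro {u} {u′} {x} same distinct ux u′x =
    T-∧-intro (eqF (bucket u) (bucket u′)) _ (fromWitness same)
      (T-∧-intro (not (eqF u u′)) _ (fromWitnessFalse distinct)
        (T-anyF-intro (λ y → G u y ∧ G u′ y) x (T-∧-intro (G u x) _ ux u′x)))

  cond3-elim : ∀ {u u′} → T (cond3 u u′) →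
               bucket u ≡ bucket u′ × u ≢ u′ × ∃ λ x → T (G u x) × T (G u′ x)
  cond3-elim {u} {u′} t with T-∧-elim (eqF (bucket u) (bucket u′)) _ t
  ... | same , t′ with T-∧-elim (not (eqF u u′)) _ t′
  ...   | distinct , ∃x with T-anyF-elim (λ y → G u y ∧ G u′ y) ∃x
  ...     | x , tx = toWitness same , toWitnessFalse distinct , x , T-∧-elim (G u x) _ tx

  E1d-intro : ∀ {v i} → T (cond1 v i) → T (E1d v (c v i))
  E1d-intro {v} {i} t = T-anyF-intro (λ j → cond1 v j ∧ eqF (c v j) (c v i)) i
                          (T-∧-intro (cond1 v i) _ t (fromWitness refl))

  E1d-elim : ∀ {v y} → T (E1d v y) → ∃ λ i → T (cond1 v i) × c v i ≡ y
  E1d-elim {v} {y} t with T-anyF-elim (λ i → cond1 v i ∧ eqF (c v i) y) t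
  ... | i , tᵢ with T-∧-elim (cond1 v i) _ tᵢ
  ...   | t₁ , cᵢ≡y = i , t₁ , toWitness cᵢ≡y

  E3d-intro : ∀ {u u′} → T (cond3 u u′) → T (E3d u (w u u′))
  E3d-intro {u} {u′} t = T-anyF-intro (λ x → cond3 u x ∧ eqF (w u x) (w u u′)) u′
                           (T-∧-intro (cond3 u u′) _ t (fromWitness refl))

  E3d-elim : ∀ {u y} → T (E3d u y) → ∃ λ u′ → T (cond3 u u′) × w u u′ ≡ y
  E3d-elim {u} {y} t with T-anyF-elim (λ u′ → cond3 u u′ ∧ eqF (w u u′) y) t
  ... | u′ , t′ with T-∧-elim (cond3 u u′) _ t′
  ...   | t₃ , w≡y = u′ , t₃ , toWitness w≡y

  HArc : Fin N → Fin N → Set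
  HArc x y = T (E1d x y) ⊎ T (E1d y x) ⊎ T (E2 x y) ⊎ T (E3d x y) ⊎ T (E3d y x)

  H-intro : ∀ {x y} → HArc x y → T (H x y)
  H-intro {x} {y} (inj₁ a) = T-∨-introˡ (E1d x y) _ a
  H-intro {x} {y} (inj₂ (inj₁ a)) = T-∨-introʳ (E1d x y) _ (T-∨-introˡ (E1d y x) _ a)
  H-intro {x} {y} (inj₂ (inj₂ (inj₁ a))) =
    T-∨-introʳ (E1d x y) _ (T-∨-introʳ (E1d y x) _ (T-∨-introˡ (E2 x y) _ a))
  H-intro {x} {y} (inj₂ (inj₂ (inj₂ (inj₁ a)))) =
    T-∨-introʳ (E1d x y) _ (T-∨-introʳ (E1d y x) _ (T-∨-introʳ (E2 x y) _ (T-∨-introˡ (E3d x y) _ a)))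
  H-intro {x} {y} (inj₂ (inj₂ (inj₂ (inj₂ a)))) =
    T-∨-introʳ (E1d x y) _ (T-∨-introʳ (E1d y x) _ (T-∨-introʳ (E2 x y) _ (T-∨-introʳ (E3d x y) _ a)))

  H-elim : ∀ {x y} → T (H x y) → HArc x y
  H-elim {x} {y} t with T-∨-elim (E1d x y) _ t
  ... | inj₁ a = inj₁ a
  ... | inj₂ t₁ with T-∨-elim (E1d y x) _ t₁
  ...   | inj₁ a = inj₂ (inj₁ a)
  ...   | inj₂ t₂ with T-∨-elim (E2 x y) _ t₂
  ...     | inj₁ a = inj₂ (inj₂ (inj₁ a))
  ...     | inj₂ t₃ with T-∨-elim (E3d x y) _ t₃
  ...       | inj₁ a = inj₂ (inj₂ (inj₂ (inj₁ a)))
  ...       | inj₂ a = inj₂ (inj₂ (inj₂ (inj₂ a)))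

  module _ (symmetric : Symmetric G) (valid-c : ValidC bucket G c) (valid-w : ValidW bucket G w) where

    flipᴳ : ∀ {x y} → T (G x y) → T (G y x)
    flipᴳ {x} {y} = subst T (symmetric x y)

    E1d⊆G : ∀ {v y} → T (E1d v y) → T (G v y)
    E1d⊆G {v} t with E1d-elim t
    ... | i , t₁ , refl with cond1-elim t₁
    ...   | v∉ , ∃u = proj₂ (valid-c v i v∉ ∃u)

    E3d⊆G : ∀ {u y} → T (E3d u y) → T (G u y)
    E3d⊆G {u} t with E3d-elim t
    ... | u′ , t₃ , refl with cond3-elim t₃
    ...   | same , distinct , ∃x = proj₁ (proj₂ valid-w u u′ same distinct ∃x)

    H⊆G : ∀ x y → T (H x y) → T (G x y)
    H⊆G x y t with H-elim t
    ... | inj₁ a                         = E1d⊆G a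
    ... | inj₂ (inj₁ a)                  = flipᴳ (E1d⊆G a)
    ... | inj₂ (inj₂ (inj₁ a))           = proj₁ (T-∧-elim (G x y) _ a)
    ... | inj₂ (inj₂ (inj₂ (inj₁ a)))    = E3d⊆G a
    ... | inj₂ (inj₂ (inj₂ (inj₂ a)))    = flipᴳ (E3d⊆G a)

    H-edge : ∀ {x y} → HArc x y → Walk H x y 1
    H-edge a = step (H-intro a) here

    detour : ∀ u v → T (G u v) → ∃ λ ℓ → ℓ ≤ 3 × Walk H u v ℓ
    detour u v uv with bucket u ≟ bucket v
    ... | yes same = 1 , s≤s z≤n , H-edge (inj₂ (inj₂ (inj₁ (T-∧-intro (G u v) _ uv (fromWitness same)))))
    ... | no differ with c u (bucket v) ≟ v
    ...   | yes c≡v =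
      1 , s≤s z≤n , subst (λ y → Walk H u y 1) c≡v (H-edge (inj₁ (E1d-intro (cond1-intro differ uv))))
    ...   | no c≢v =
      3 , ≤-refl , H-edge (inj₁ u→c) ++ᵂ (H-edge (inj₂ (inj₂ (inj₂ (inj₁ c→z)))) ++ᵂ H-edge z←v)
      where
      c′ : Fin N
      c′ = c u (bucket v)
      c′-valid : bucket c′ ≡ bucket v × T (G u c′)
      c′-valid = valid-c u (bucket v) differ (v , refl , uv)
      u→c : T (E1d u c′)
      u→c = E1d-intro (cond1-intro differ uv)
      c→z : T (E3d c′ (w c′ v))
      c→z = E3d-intro (cond3-intro (proj₁ c′-valid) c≢v (flipᴳ (proj₂ c′-valid)) (flipᴳ uv))
      z←v : HArc (w c′ v) v
      z←v = inj₂ (inj₂ (inj₂ (inj₂ (subst (T ∘ E3d v) (proj₁ valid-w v c′)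
              (E3d-intro (cond3-intro (sym (proj₁ c′-valid)) (c≢v ∘ sym) (flipᴳ uv) (flipᴳ (proj₂ c′-valid))))))))

  module _ (equal-buckets : EqualBuckets bucket k) where

    countF-bucketmates : ∀ x (P : Fin N → Bool) → (∀ y → T (P y) → bucket y ≡ bucket x) → countF P ≤ k
    countF-bucketmates x P P⊆mates = begin
      countF P                                 ≤⟨ countF-mono (λ y → fromWitness ∘ P⊆mates y) ⟩
      countF (λ y → ⌊ bucket y ≟ bucket x ⌋)   ≡⟨ equal-buckets (bucket x) ⟩
      k                                        ∎
      where open ≤-Reasoning

    E1d-outdegree : ∀ x → countF (E1d x) ≤ k
    E1d-outdegree x = ≤-trans (countF-image (cond1 x) (c x)) (countF-≤ (cond1 x))

    E2-outdegree : ∀ x → countF (E2 x) ≤ k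
    E2-outdegree x = countF-bucketmates x (E2 x) (λ y → sym ∘ toWitness ∘ proj₂ ∘ T-∧-elim (G x y) _)

    E3d-outdegree : ∀ x → countF (E3d x) ≤ k
    E3d-outdegree x = ≤-trans (countF-image (cond3 x) (w x))
                              (countF-bucketmates x (cond3 x) (λ y → sym ∘ proj₁ ∘ cond3-elim))

    arcCount-H : arcCount H ≤ 5 * (N * k)
    arcCount-H = subst (arcCount H ≤_) (cong (λ t → N * k + (N * k + (N * k + (N * k + t)))) (sym (+-identityʳ (N * k))))
      (arcCount-∨ E1d _ E1d-arcs
        (arcCount-∨ (λ x y → E1d y x) _ (transposed E1d E1d-arcs)
          (arcCount-∨ E2 _ (arcCount-≤ E2 E2-outdegree)
            (arcCount-∨ E3d (λ x y → E3d y x) E3d-arcs (transposed E3d E3d-arcs)))))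
      where
      E1d-arcs : arcCount E1d ≤ N * k
      E1d-arcs = arcCount-≤ E1d E1d-outdegree
      E3d-arcs : arcCount E3d ≤ N * k
      E3d-arcs = arcCount-≤ E3d E3d-outdegree
      transposed : ∀ B → arcCount B ≤ N * k → arcCount (λ x y → B y x) ≤ N * k
      transposed B = ≤-trans (≤-reflexive (arcCount-transpose B))

claim7 : ∃₂ λ (C N₀ : ℕ) → (k : ℕ) → (G : Graph (k * k)) → Symmetric G → Irreflexive G →
           (bucket : Fin (k * k) → Fin k) → EqualBuckets bucket k →
           (c : Fin (k * k) → Fin k → Fin (k * k)) → ValidC bucket G c →
           (w : Fin (k * k) → Fin (k * k) → Fin (k * k)) → ValidW bucket G w →
           IsSpanner3 G (Construction.H bucket G c w) ×
           (N₀ ≤ k * k → edgeCount (Construction.H bucket G c w) ≤ C * ((k * k) * k))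
claim7 = 5 , 0 , λ k G symmetric _ bucket equal-buckets c valid-c w valid-w →
  let open SpannerConstruction bucket G c w
  in (H⊆G symmetric valid-c valid-w , walk-stretch 3 (detour symmetric valid-c valid-w))
   , λ _ → ≤-trans (edgeCount≤arcCount (Construction.H bucket G c w)) (arcCount-H equal-buckets)
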